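{- Let $r, k, n \in \mathbb{N}$ with $r \leq n$, let $\mathcal{F}_1, \ldots, \mathcal{F}_r \subset \binom{[n]}{k}$ and let $\mathcal{F} = \mathcal{F}_1 \cup \cdots \cup \mathcal{F}_r$. Then $$|\mathcal{F}| \leq \binom{n}{k} - \binom{n-r}{k} + \sum_{j=1}^r \left( \left|(\mathcal{F}_j)_{\{j\}}^{\varnothing}\right| - \left|\binom{[n]\setminus[r]}{k-1} \setminus (\mathcal{F}_j)_{[r]}^{\{j\}}\right| \right).$$
   Context: $\binom{X}{m}$ is the set of $m$-element subsets of $X$. For $\mathcal{G} \subset \mathcal{P}([n])$ and $C \subset B \subset [n]$, $\mathcal{G}_B^C = \{S \subset [n]\setminus B : S \cup C \in \mathcal{G}\}$. Thus $(\mathcal{F}_j)_{\{j\}}^{\varnothing} = \{S \in \mathcal{F}_j : j \notin S\}$ and $(\mathcal{F}_j)_{[r]}^{\{j\}} = \{S \subset [n]\setminus[r] : S \cup \{j\} \in \mathcal{F}_j\}$. -}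

module Defs where

open import Data.Bool using (Bool; true; false; not; _∧_; _∨_)
open import Data.Nat using (ℕ; zero; suc; _≤_; _<ᵇ_; _≡ᵇ_; _∸_)
open import Data.Fin using (Fin; toℕ; inject≤)
open import Data.Fin.Subset using (Subset; ⁅_⁆; _∪_; ∣_∣; inside; outside)
open import Data.Fin.Subset.Properties using (_∈?_; _⊆?_)
open import Data.Vec using (Vec; []; _∷_; tabulate)
open import Data.List using (List; []; _∷_; map; _++_; filter; length; foldr; allFin)
open import Data.Integer using (ℤ; _+_; _-_; +_)
open import Relation.Nullary using (does)
open import Relation.Nullary.Decidable using (T?)

Family : ℕ → Set
Family n = Subset n → Bool

allSubsets : (n : ℕ) → List (Subset n)
allSubsets zero = [] ∷ []
allSubsets (suc n) = map (inside ∷_) (allSubsets n) ++ map (outside ∷_) (allSubsets n)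

card : {n : ℕ} → Family n → ℕ
card {n} 𝒢 = length (filter (λ S → T? (𝒢 S)) (allSubsets n))

sumℤ : (r : ℕ) → (Fin r → ℤ) → ℤ
sumℤ r f = foldr (λ j acc → f j + acc) (+ 0) (allFin r)

-- [r] as a subset of [n]: the first r elements (indices 0..r-1).
firstR : (n r : ℕ) → Subset n
firstR n r = tabulate (λ i → toℕ i <ᵇ r)

restR : (n r : ℕ) → Subset n
restR n r = tabulate (λ i → not (toℕ i <ᵇ r))

⋃F : {n r : ℕ} → (Fin r → Family n) → Family n
⋃F {r = r} F S = foldr (λ j b → F j S ∨ b) false (allFin r)

-- (𝒢)_{{j}}^{∅} = { S ∈ 𝒢 : j ∉ S }  (as a family of subsets of [n]∖{j})
F-without : {n : ℕ} → Family n → Fin n → Family n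
F-without 𝒢 j S = 𝒢 S ∧ not (does (j ∈? S))

-- (𝒢)_{[r]}^{{j}} = { S ⊆ [n]∖[r] : S ∪ {j} ∈ 𝒢 }
F-link : {n : ℕ} → (r : ℕ) → Family n → Fin n → Family n
F-link {n} r 𝒢 j S = does (S ⊆? restR n r) ∧ 𝒢 (S ∪ ⁅ j ⁆)

binomRest : (n r m : ℕ) → Family n
binomRest n r m S = does (S ⊆? restR n r) ∧ (∣ S ∣ ≡ᵇ m)

-- binom([n]∖[r], k-1) ∖ (𝒢)_{[r]}^{{j}}, with binom(X, -1) = ∅ when k = 0
missingLink : (n r k : ℕ) → Family n → Fin n → Family n
missingLink n r zero 𝒢 j S = false
missingLink n r (suc k) 𝒢 j S = binomRest n r k S ∧ not (F-link r 𝒢 j S)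

-- Double counting over all subsets S of [n].  Call a k-set S free if S ∩ [r] = ∅, and
-- j-missing if S ∩ [r] = {j} and S ∉ F_j.  There are C(n−r,k) free sets, and S ↦ S ∖ {j}
-- puts the j-missing sets in bijection with binom([n]∖[r], k−1) ∖ (F_j)^{j}_{[r]}.  The
-- free and missing sets are pairwise disjoint k-sets.  A set S ∈ F_j with j ∉ S lies in
-- (F_j)^∅_{j}; a set S ∈ F_j with j ∈ S is neither free nor j′-missing (that would force
-- j′ = j and S ∉ F_j).  Hence, for every S,
--   [S ∈ F] + [S free or missing] ≤ [|S| = k] + #{j : S ∈ (F_j)^∅_{j}},
-- and summing over S gives the bound.
module Submission where

open import Defs
open import Data.Bool using (Bool; true; false; not; _∧_; _∨_; T)
open import Data.Bool.Properties using (T-≡; T-∧; T-not-≡)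
open import Data.Fin using (Fin; zero; suc; toℕ; inject≤)
open import Data.Fin.Subset using (Subset; inside; outside; _∈_; _∉_; _⊆_; _∪_; ⁅_⁆; ∣_∣)
open import Data.Fin.Subset.Properties using (_∈?_; _⊆?_)
open import Data.Nat using (ℕ; zero; suc; _≤_; _<_; _∸_; z≤n; s≤s; _≡ᵇ_)
import Data.Nat as ℕ
open import Data.Nat.Combinatorics using (_C_)
open import Data.Nat.Properties using (+-0-commutativeMonoid)
open import Algebra.Properties.CommutativeMonoid.Sum +-0-commutativeMonoid using (sum-syntax)
open import Data.Product using (_×_; _,_; proj₁; proj₂)
open import Function using (_∘_; id; Equivalence)
open import Relation.Nullary using (¬_; Dec; does; yes; no; contradiction)
open import Relation.Binary.PropositionalEquality
open Equivalence using (to; from)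

module Counting where

  open import Algebra.Properties.CommutativeSemigroup using (interchange)
  open import Algebra.Properties.CommutativeMonoid.Sum +-0-commutativeMonoid using (∑-distrib-+)
  open import Data.Fin.Properties using (suc-injective)
  open import Data.Fin.Subset using (_─_; _-_; ⊥)
  open import Data.Fin.Subset.Properties using (p─⊥≡p; ∪-identityʳ)
  open import Data.List using (List; []; _∷_; map; _++_; filter; length; foldr)
  open import Data.List.Properties using (map-++; map-∘)
  open import Data.List.Relation.Unary.Any using (Any; here; there)
  open import Data.Nat using (_+_; _<ᵇ_)
  open import Data.Nat.Combinatorics using (nCk+nC[k+1]≡[n+1]C[k+1])
  open import Data.Nat.ListAction using (sum)
  open import Data.Nat.ListAction.Properties using (sum-++)
  open import Data.Nat.Properties
    using (+-commutativeSemigroup; +-identityʳ; +-mono-≤; ≤-trans; m≤m+n; m≤n+m; ≮⇒≥; <⇒<ᵇ; ≡ᵇ⇒≡)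
  open import Data.Vec using ([]; _∷_; here; there)
  open import Data.Vec.Properties using ([]=⇒lookup; lookup∘tabulate)
  open import Relation.Nullary.Decidable using (T?)

  χ : Bool → ℕ
  χ true  = 1
  χ false = 0

  1≤χ : {b : Bool} → T b → 1 ≤ χ b
  1≤χ {true} _ = s≤s z≤n

  T-does⇒ : {P : Set} (d : Dec P) → T (does d) → P
  T-does⇒ (yes p) _ = p

  T-foldr-∨⇒Any : {A : Set} (g : A → Bool) (xs : List A) →
    T (foldr (λ x b → g x ∨ b) false xs) → Any (T ∘ g) xs
  T-foldr-∨⇒Any g (x ∷ xs) t with g x in gx
  ... | true  = here (from T-≡ gx)
  ... | false = there (T-foldr-∨⇒Any g xs t)

  term≤∑ : {m : ℕ} (f : Fin m → ℕ) (i : Fin m) → f i ≤ ∑[ j < m ] f j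
  term≤∑ f zero    = m≤m+n (f zero) _
  term≤∑ f (suc i) = ≤-trans (term≤∑ (f ∘ suc) i) (m≤n+m _ (f zero))

  ∑-χ≤χ : {m : ℕ} (f : Fin m → Bool) (b : Bool) →
    (∀ i j → T (f i) → T (f j) → i ≡ j) → (∀ i → T (f i) → T b) →
    ∑[ i < m ] χ (f i) ≤ χ b
  ∑-χ≤χ {zero}  f b exclusive implies = z≤n
  ∑-χ≤χ {suc m} f b exclusive implies with f zero in f₀
  ... | false = ∑-χ≤χ (f ∘ suc) b (λ i j fi fj → suc-injective (exclusive _ _ fi fj)) (implies ∘ suc)
  ... | true with b | implies zero (from T-≡ f₀)
  ...   | true | _ = s≤s (∑-χ≤χ (f ∘ suc) false (λ i j fi fj → suc-injective (exclusive _ _ fi fj))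
                       (λ i fi → contradiction (exclusive zero (suc i) (from T-≡ f₀) fi) λ ()))

  ∑ₛ : (n : ℕ) → (Subset n → ℕ) → ℕ
  ∑ₛ zero    f = f []
  ∑ₛ (suc n) f = ∑ₛ n (f ∘ (inside ∷_)) + ∑ₛ n (f ∘ (outside ∷_))

  length-filter≡sum-χ : {A : Set} (P : A → Bool) (xs : List A) →
    length (filter (T? ∘ P) xs) ≡ sum (map (χ ∘ P) xs)
  length-filter≡sum-χ P []       = refl
  length-filter≡sum-χ P (x ∷ xs) with P x
  ... | true  = cong suc (length-filter≡sum-χ P xs)
  ... | false = length-filter≡sum-χ P xs

  sum-map-allSubsets : (n : ℕ) (f : Subset n → ℕ) → sum (map f (allSubsets n)) ≡ ∑ₛ n f
  sum-map-allSubsets zero    f = +-identityʳ (f [])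
  sum-map-allSubsets (suc n) f = begin
    sum (map f (map (inside ∷_) Ss ++ map (outside ∷_) Ss))
      ≡⟨ cong sum (map-++ f (map (inside ∷_) Ss) _) ⟩
    sum (map f (map (inside ∷_) Ss) ++ map f (map (outside ∷_) Ss))
      ≡⟨ sum-++ (map f (map (inside ∷_) Ss)) _ ⟩
    sum (map f (map (inside ∷_) Ss)) + sum (map f (map (outside ∷_) Ss))
      ≡⟨ cong₂ (λ xs ys → sum xs + sum ys) (map-∘ Ss) (map-∘ Ss) ⟨
    sum (map (f ∘ (inside ∷_)) Ss) + sum (map (f ∘ (outside ∷_)) Ss)
      ≡⟨ cong₂ _+_ (sum-map-allSubsets n _) (sum-map-allSubsets n _) ⟩
    ∑ₛ (suc n) f ∎
    where
    open ≡-Reasoning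
    Ss : List (Subset n)
    Ss = allSubsets n

  card≡∑ₛ : {n : ℕ} (𝒢 : Family n) → card 𝒢 ≡ ∑ₛ n (χ ∘ 𝒢)
  card≡∑ₛ {n} 𝒢 = trans (length-filter≡sum-χ 𝒢 (allSubsets n)) (sum-map-allSubsets n (χ ∘ 𝒢))

  ∑ₛ-cong : (n : ℕ) {f g : Subset n → ℕ} → (∀ S → f S ≡ g S) → ∑ₛ n f ≡ ∑ₛ n g
  ∑ₛ-cong zero    f≗g = f≗g []
  ∑ₛ-cong (suc n) f≗g = cong₂ _+_ (∑ₛ-cong n (f≗g ∘ (inside ∷_))) (∑ₛ-cong n (f≗g ∘ (outside ∷_)))

  ∑ₛ-mono-≤ : (n : ℕ) {f g : Subset n → ℕ} → (∀ S → f S ≤ g S) → ∑ₛ n f ≤ ∑ₛ n g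
  ∑ₛ-mono-≤ zero    f≤g = f≤g []
  ∑ₛ-mono-≤ (suc n) f≤g = +-mono-≤ (∑ₛ-mono-≤ n (f≤g ∘ (inside ∷_))) (∑ₛ-mono-≤ n (f≤g ∘ (outside ∷_)))

  ∑ₛ-zero : (n : ℕ) → ∑ₛ n (λ _ → 0) ≡ 0
  ∑ₛ-zero zero    = refl
  ∑ₛ-zero (suc n) = cong₂ _+_ (∑ₛ-zero n) (∑ₛ-zero n)

  ∑ₛ-distrib-+ : (n : ℕ) (f g : Subset n → ℕ) → ∑ₛ n (λ S → f S + g S) ≡ ∑ₛ n f + ∑ₛ n g
  ∑ₛ-distrib-+ zero    f g = refl
  ∑ₛ-distrib-+ (suc n) f g = trans
    (cong₂ _+_ (∑ₛ-distrib-+ n (f ∘ (inside ∷_)) _) (∑ₛ-distrib-+ n (f ∘ (outside ∷_)) _))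
    (interchange +-commutativeSemigroup (∑ₛ n (f ∘ (inside ∷_))) (∑ₛ n (g ∘ (inside ∷_)))
                                        (∑ₛ n (f ∘ (outside ∷_))) (∑ₛ n (g ∘ (outside ∷_))))

  ∑ₛ-∑-comm : (n m : ℕ) (f : Fin m → Subset n → ℕ) →
    ∑ₛ n (λ S → ∑[ i < m ] f i S) ≡ ∑[ i < m ] ∑ₛ n (f i)
  ∑ₛ-∑-comm zero    m f = refl
  ∑ₛ-∑-comm (suc n) m f = trans
    (cong₂ _+_ (∑ₛ-∑-comm n m (λ i → f i ∘ (inside ∷_))) (∑ₛ-∑-comm n m (λ i → f i ∘ (outside ∷_))))
    (sym (∑-distrib-+ (λ i → ∑ₛ n (f i ∘ (inside ∷_))) _))

  ∑ₛ-size≡C : (n k : ℕ) → ∑ₛ n (λ S → χ (∣ S ∣ ≡ᵇ k)) ≡ n C k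
  ∑ₛ-size≡C zero    zero    = refl
  ∑ₛ-size≡C zero    (suc k) = refl
  ∑ₛ-size≡C (suc n) zero    = cong₂ _+_ (∑ₛ-zero n) (∑ₛ-size≡C n zero)
  ∑ₛ-size≡C (suc n) (suc k) = trans (cong₂ _+_ (∑ₛ-size≡C n k) (∑ₛ-size≡C n (suc k)))
                                    (nCk+nC[k+1]≡[n+1]C[k+1] n k)

  ⊆?restR-zero : {n : ℕ} (S : Subset n) → does (S ⊆? restR n 0) ≡ true
  ⊆?restR-zero []          = refl
  ⊆?restR-zero (inside ∷ S)  = ⊆?restR-zero S
  ⊆?restR-zero (outside ∷ S) = ⊆?restR-zero S

  ∑ₛ-binomRest≡C : (n r k : ℕ) → r ≤ n → ∑ₛ n (χ ∘ binomRest n r k) ≡ (n ∸ r) C k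
  ∑ₛ-binomRest≡C n zero k _ = trans
    (∑ₛ-cong n (λ S → cong (λ b → χ (b ∧ (∣ S ∣ ≡ᵇ k))) (⊆?restR-zero S)))
    (∑ₛ-size≡C n k)
  ∑ₛ-binomRest≡C (suc n) (suc r) k (s≤s r≤n) =
    cong₂ _+_ (∑ₛ-zero n) (∑ₛ-binomRest≡C n r k r≤n)

  ∑ₛ-∉≡∑ₛ-∈ : (n : ℕ) (x : Fin n) (R : Subset n → Bool) →
    ∑ₛ n (λ S → χ (not (does (x ∈? S)) ∧ R S)) ≡ ∑ₛ n (λ S → χ (does (x ∈? S) ∧ R (S - x)))
  ∑ₛ-∉≡∑ₛ-∈ (suc n) zero R = begin
    ∑ₛ n (λ _ → 0) + ∑ₛ n avoid0   ≡⟨ cong (_+ ∑ₛ n avoid0) (∑ₛ-zero n) ⟩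
    ∑ₛ n avoid0                    ≡⟨ ∑ₛ-cong n (λ S → cong (χ ∘ R ∘ (outside ∷_)) (sym (p─⊥≡p S))) ⟩
    ∑ₛ n remove0                   ≡⟨ +-identityʳ _ ⟨
    ∑ₛ n remove0 + 0               ≡⟨ cong (∑ₛ n remove0 +_) (∑ₛ-zero n) ⟨
    ∑ₛ n remove0 + ∑ₛ n (λ _ → 0)  ∎
    where
    open ≡-Reasoning
    avoid0 remove0 : Subset n → ℕ
    avoid0 S  = χ (R (outside ∷ S))
    remove0 S = χ (R ((inside ∷ S) - zero))
  ∑ₛ-∉≡∑ₛ-∈ (suc n) (suc x) R =
    cong₂ _+_ (∑ₛ-∉≡∑ₛ-∈ n x (R ∘ (inside ∷_))) (∑ₛ-∉≡∑ₛ-∈ n x (R ∘ (outside ∷_)))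

  x∈p⇒∣p∣≡1+∣p-x∣ : {n : ℕ} {x : Fin n} {p : Subset n} → x ∈ p → ∣ p ∣ ≡ suc ∣ p - x ∣
  x∈p⇒∣p∣≡1+∣p-x∣ {x = zero}  {inside ∷ p}  here        = cong (suc ∘ ∣_∣) (sym (p─⊥≡p p))
  x∈p⇒∣p∣≡1+∣p-x∣ {x = suc x} {inside ∷ p}  (there x∈p) = cong suc (x∈p⇒∣p∣≡1+∣p-x∣ x∈p)
  x∈p⇒∣p∣≡1+∣p-x∣ {x = suc x} {outside ∷ p} (there x∈p) = x∈p⇒∣p∣≡1+∣p-x∣ x∈p

  x∈p⇒p-x∪⁅x⁆≡p : {n : ℕ} {x : Fin n} {p : Subset n} → x ∈ p → (p - x) ∪ ⁅ x ⁆ ≡ p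
  x∈p⇒p-x∪⁅x⁆≡p {x = zero}  {inside ∷ p}  here        =
    cong (inside ∷_) (trans (∪-identityʳ (p ─ ⊥)) (p─⊥≡p p))
  x∈p⇒p-x∪⁅x⁆≡p {x = suc x} {inside ∷ p}  (there x∈p) = cong (inside ∷_) (x∈p⇒p-x∪⁅x⁆≡p x∈p)
  x∈p⇒p-x∪⁅x⁆≡p {x = suc x} {outside ∷ p} (there x∈p) = cong (outside ∷_) (x∈p⇒p-x∪⁅x⁆≡p x∈p)

  ∈restR⇒≥ : {n r : ℕ} {i : Fin n} → i ∈ restR n r → r ≤ toℕ i
  ∈restR⇒≥ {n} {r} {i} i∈R = ≮⇒≥ λ i<r →
    contradiction (trans (cong not (sym (to T-≡ (<⇒<ᵇ i<r)))) lookup≡true) λ ()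
    where
    lookup≡true : not (toℕ i <ᵇ r) ≡ true
    lookup≡true = trans (sym (lookup∘tabulate _ i)) ([]=⇒lookup i∈R)

  binomRest⇒ : {n r m : ℕ} {S : Subset n} → T (binomRest n r m S) → S ⊆ restR n r × ∣ S ∣ ≡ m
  binomRest⇒ {n} {r} {S = S} t with to T-∧ t
  ... | S⊆R , ∣S∣≡m = T-does⇒ (S ⊆? restR n r) S⊆R , ≡ᵇ⇒≡ _ _ ∣S∣≡m

  missingLink⇒ : {n r k : ℕ} {𝒢 : Family n} {x : Fin n} {S : Subset n} →
    T (missingLink n r k 𝒢 x S) → S ⊆ restR n r × suc ∣ S ∣ ≡ k × ¬ T (𝒢 (S ∪ ⁅ x ⁆))
  missingLink⇒ {n} {r} {suc k} {𝒢} {x} {S} t with to T-∧ t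
  ... | inBinom , notInLink with binomRest⇒ {n} {r} {k} {S} inBinom
  ... | S⊆R , ∣S∣≡k = S⊆R , cong suc ∣S∣≡k , λ 𝒢S∪x →
    subst T (to T-not-≡ notInLink) (from T-∧ (proj₁ (to T-∧ inBinom) , 𝒢S∪x))

module UnionBound (r k n : ℕ) (r≤n : r ≤ n) (F : Fin r → Family n)
  (F-size : ∀ j S → F j S ≡ true → ∣ S ∣ ≡ k) where

  open Counting
  open import Data.Fin using (_≟_)
  open import Data.Fin.Properties using (toℕ-inject≤; toℕ<n; inject≤-injective)
  open import Data.Fin.Subset using (_-_)
  open import Data.Fin.Subset.Properties using (x∈p∧x≢y⇒x∈p-y)
  open import Data.List using (allFin)
  open import Data.List.Relation.Unary.Any using (satisfied)
  open import Data.Nat using (_+_)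
  open import Data.Nat.Properties
    using (+-comm; +-mono-≤; ≤-trans; ≤-reflexive; m≤m+n; <⇒≱; ≡⇒≡ᵇ; module ≤-Reasoning)
  open import Algebra.Properties.CommutativeMonoid.Sum +-0-commutativeMonoid using (sum-cong-≗)
  open import Relation.Nullary.Decidable using (T?; dec-false)

  ι : Fin r → Fin n
  ι j = inject≤ j r≤n

  ι∉restR : ∀ j → ι j ∉ restR n r
  ι∉restR j ιj∈R = <⇒≱ ι<r (∈restR⇒≥ ιj∈R)
    where
    ι<r : toℕ (ι j) < r
    ι<r = subst (_< r) (sym (toℕ-inject≤ j r≤n)) (toℕ<n j)

  liftedMissing : Fin r → Family n
  liftedMissing j S = does (ι j ∈? S) ∧ missingLink n r k (F j) (ι j) (S - ι j)

  -- Index zero: the free sets; index suc j: the j-missing sets.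
  traceClass : Fin (suc r) → Family n
  traceClass zero    = binomRest n r k
  traceClass (suc j) = liftedMissing j

  module _ {j : Fin r} {S : Subset n} (t : T (liftedMissing j S)) where

    private
      unlinked : S - ι j ⊆ restR n r × suc ∣ S - ι j ∣ ≡ k × ¬ T (F j ((S - ι j) ∪ ⁅ ι j ⁆))
      unlinked = missingLink⇒ {n} {r} {k} {F j} {ι j} {S - ι j} (proj₂ (to T-∧ t))

    liftedMissing⇒∈ : ι j ∈ S
    liftedMissing⇒∈ = T-does⇒ (ι j ∈? S) (proj₁ (to T-∧ t))

    liftedMissing⇒only : ∀ i → ι i ∈ S → i ≡ j
    liftedMissing⇒only i ιi∈S with i ≟ j
    ... | yes i≡j = i≡j
    ... | no  i≢j = contradiction
      (proj₁ unlinked (x∈p∧x≢y⇒x∈p-y ιi∈S (i≢j ∘ inject≤-injective r≤n r≤n i j)))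
      (ι∉restR i)

    liftedMissing⇒size : ∣ S ∣ ≡ k
    liftedMissing⇒size = trans (x∈p⇒∣p∣≡1+∣p-x∣ liftedMissing⇒∈) (proj₁ (proj₂ unlinked))

    liftedMissing⇒∉F : ¬ T (F j S)
    liftedMissing⇒∉F = subst (¬_ ∘ T ∘ F j) (x∈p⇒p-x∪⁅x⁆≡p liftedMissing⇒∈) (proj₂ (proj₂ unlinked))

  binomRest-avoids : ∀ {j S} → T (binomRest n r k S) → ι j ∉ S
  binomRest-avoids {j} {S} t ιj∈S = ι∉restR j (proj₁ (binomRest⇒ {n} {r} {k} {S} t) ιj∈S)

  module _ {S : Subset n} where

    traceClass-exclusive : ∀ i i′ → T (traceClass i S) → T (traceClass i′ S) → i ≡ i′
    traceClass-exclusive zero    zero    _ _  = refl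
    traceClass-exclusive zero    (suc j) t t′ = contradiction (liftedMissing⇒∈ t′) (binomRest-avoids t)
    traceClass-exclusive (suc i) zero    t t′ = contradiction (liftedMissing⇒∈ t) (binomRest-avoids t′)
    traceClass-exclusive (suc i) (suc j) t t′ = cong suc (liftedMissing⇒only t′ i (liftedMissing⇒∈ t))

    traceClass⇒size : ∀ i → T (traceClass i S) → T (∣ S ∣ ≡ᵇ k)
    traceClass⇒size zero    t = ≡⇒≡ᵇ _ _ (proj₂ (binomRest⇒ {n} {r} {k} {S} t))
    traceClass⇒size (suc j) t = ≡⇒≡ᵇ _ _ (liftedMissing⇒size t)

    ∈F⇒¬traceClass : ∀ {j} → ι j ∈ S → T (F j S) → ∀ i → ¬ T (traceClass i S)
    ∈F⇒¬traceClass ιj∈S FjS zero    t = binomRest-avoids t ιj∈S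
    ∈F⇒¬traceClass ιj∈S FjS (suc i) t with liftedMissing⇒only t _ ιj∈S
    ... | refl = liftedMissing⇒∉F t FjS

    ∑-traceClass≤χ : (b : Bool) → (∀ i → T (traceClass i S) → T b) →
      ∑[ i < suc r ] χ (traceClass i S) ≤ χ b
    ∑-traceClass≤χ b = ∑-χ≤χ (λ i → traceClass i S) b traceClass-exclusive

  pointwise-bound : ∀ S → χ (⋃F F S) + ∑[ i < suc r ] χ (traceClass i S)
                  ≤ χ (∣ S ∣ ≡ᵇ k) + ∑[ j < r ] χ (F-without (F j) (ι j) S)
  pointwise-bound S with ⋃F F S in ⋃FS
  ... | false = ≤-trans (∑-traceClass≤χ _ traceClass⇒size) (m≤m+n _ _)
  ... | true with satisfied (T-foldr-∨⇒Any (λ j → F j S) (allFin r) (from T-≡ ⋃FS))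
  ...   | j , FjS with ι j ∈? S
  ...     | yes ιj∈S = +-mono-≤ (1≤χ (≡⇒≡ᵇ _ _ (F-size j S (to T-≡ FjS))))
                                 (≤-trans (∑-traceClass≤χ false (∈F⇒¬traceClass ιj∈S FjS)) z≤n)
  ...     | no  ιj∉S = ≤-trans
    (+-mono-≤ (≤-trans (1≤χ FjS∖ιj) (term≤∑ W j)) (∑-traceClass≤χ _ traceClass⇒size))
    (≤-reflexive (+-comm (∑[ j < r ] W j) (χ (∣ S ∣ ≡ᵇ k))))
    where
    W : Fin r → ℕ
    W j = χ (F-without (F j) (ι j) S)
    FjS∖ιj : T (F-without (F j) (ι j) S)
    FjS∖ιj = from T-∧ (FjS , from T-not-≡ (dec-false (ι j ∈? S) ιj∉S))

  card-missingLink≡∑ₛ-liftedMissing : ∀ j →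
    card (missingLink n r k (F j) (ι j)) ≡ ∑ₛ n (χ ∘ liftedMissing j)
  card-missingLink≡∑ₛ-liftedMissing j = begin
    card missing                                        ≡⟨ card≡∑ₛ missing ⟩
    ∑ₛ n (χ ∘ missing)                                  ≡⟨ ∑ₛ-cong n avoids-ιj ⟩
    ∑ₛ n (λ S → χ (not (does (ι j ∈? S)) ∧ missing S))  ≡⟨ ∑ₛ-∉≡∑ₛ-∈ n (ι j) missing ⟩
    ∑ₛ n (χ ∘ liftedMissing j)                          ∎
    where
    open ≡-Reasoning
    missing : Family n
    missing = missingLink n r k (F j) (ι j)
    avoids-ιj : ∀ S → χ (missing S) ≡ χ (not (does (ι j ∈? S)) ∧ missing S)
    avoids-ιj S with ι j ∈? S
    ... | no  _    = refl
    ... | yes ιj∈S = cong χ (dec-false (T? (missing S))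
                       λ t → ι∉restR j (proj₁ (missingLink⇒ {n} {r} {k} {F j} {ι j} {S} t) ιj∈S))

  card-⋃F-bound : card (⋃F F) + ((n ∸ r) C k + ∑[ j < r ] card (missingLink n r k (F j) (ι j)))
             ≤ n C k + ∑[ j < r ] card (F-without (F j) (ι j))
  card-⋃F-bound = begin
    card (⋃F F) + ((n ∸ r) C k + ∑[ j < r ] card (missingLink n r k (F j) (ι j)))
      ≡⟨ cong₂ _+_ (card≡∑ₛ (⋃F F)) (cong₂ _+_ (sym (∑ₛ-binomRest≡C n r k r≤n))
                                            (sum-cong-≗ card-missingLink≡∑ₛ-liftedMissing)) ⟩
    ∑ₛ n (χ ∘ ⋃F F) + ∑[ i < suc r ] ∑ₛ n (χ ∘ traceClass i)
      ≡⟨ cong (∑ₛ n (χ ∘ ⋃F F) +_) (∑ₛ-∑-comm n (suc r) (λ i → χ ∘ traceClass i)) ⟨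
    ∑ₛ n (χ ∘ ⋃F F) + ∑ₛ n (λ S → ∑[ i < suc r ] χ (traceClass i S))
      ≡⟨ ∑ₛ-distrib-+ n (χ ∘ ⋃F F) _ ⟨
    ∑ₛ n (λ S → χ (⋃F F S) + ∑[ i < suc r ] χ (traceClass i S))
      ≤⟨ ∑ₛ-mono-≤ n pointwise-bound ⟩
    ∑ₛ n (λ S → χ (∣ S ∣ ≡ᵇ k) + ∑[ j < r ] χ (F-without (F j) (ι j) S))
      ≡⟨ ∑ₛ-distrib-+ n (λ S → χ (∣ S ∣ ≡ᵇ k)) _ ⟩
    ∑ₛ n (λ S → χ (∣ S ∣ ≡ᵇ k)) + ∑ₛ n (λ S → ∑[ j < r ] χ (F-without (F j) (ι j) S))
      ≡⟨ cong₂ _+_ (∑ₛ-size≡C n k) (∑ₛ-∑-comm n r (λ j → χ ∘ F-without (F j) (ι j))) ⟩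
    n C k + ∑[ j < r ] ∑ₛ n (χ ∘ F-without (F j) (ι j))
      ≡⟨ cong (n C k +_) (sum-cong-≗ (λ j → card≡∑ₛ (F-without (F j) (ι j)))) ⟨
    n C k + ∑[ j < r ] card (F-without (F j) (ι j))  ∎
    where open ≤-Reasoning

open import Data.Integer using (+_; -_; _+_; _-_; +≤+) renaming (_≤_ to _≤ℤ_)
open import Data.Integer.Properties using (pos-+; +-monoˡ-≤; module ≤-Reasoning)
open import Data.Integer.Tactic.RingSolver using (solve-∀)
open import Data.List using (foldr; tabulate)

pos-sub-+-pos-sub : ∀ a b c d → (+ a - + b) + (+ c - + d) ≡ + (a ℕ.+ c) - + (b ℕ.+ d)
pos-sub-+-pos-sub a b c d rewrite pos-+ a c | pos-+ b d = shuffle (+ a) (+ b) (+ c) (+ d)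
  where
  shuffle : ∀ w x y z → (w - x) + (y - z) ≡ (w + y) - (x + z)
  shuffle = solve-∀

sumℤ-pos-sub : (r : ℕ) (a b : Fin r → ℕ) →
  sumℤ r (λ j → + a j - + b j) ≡ + ∑[ j < r ] a j - + ∑[ j < r ] b j
sumℤ-pos-sub r a b = foldr-tabulate id
  where
  foldr-tabulate : {m : ℕ} (h : Fin m → Fin r) →
    foldr (λ j acc → (+ a j - + b j) + acc) (+ 0) (tabulate h)
      ≡ + ∑[ i < m ] a (h i) - + ∑[ i < m ] b (h i)
  foldr-tabulate {zero}  h = refl
  foldr-tabulate {suc m} h = trans
    (cong (_+_ (+ a (h zero) - + b (h zero))) (foldr-tabulate (h ∘ suc)))
    (pos-sub-+-pos-sub (a (h zero)) (b (h zero)) (∑[ i < m ] a (h (suc i))) (∑[ i < m ] b (h (suc i))))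

m+[o+n]≤p+q⇒m≤[p-o]+[q-n] : ∀ {m n o p q} → m ℕ.+ (o ℕ.+ n) ≤ p ℕ.+ q →
  + m ≤ℤ (+ p - + o) + (+ q - + n)
m+[o+n]≤p+q⇒m≤[p-o]+[q-n] {m} {n} {o} {p} {q} m+x≤p+q = begin
  + m                          ≡⟨ add-sub (+ m) (+ x) ⟩
  (+ m + + x) - + x            ≡⟨ cong (_- + x) (pos-+ m x) ⟨
  + (m ℕ.+ x) - + x            ≤⟨ +-monoˡ-≤ (- + x) (+≤+ m+x≤p+q) ⟩
  + (p ℕ.+ q) - + (o ℕ.+ n)    ≡⟨ pos-sub-+-pos-sub p o q n ⟨
  (+ p - + o) + (+ q - + n)    ∎
  where
  open ≤-Reasoning
  x : ℕ
  x = o ℕ.+ n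
  add-sub : ∀ i j → i ≡ (i + j) - j
  add-sub = solve-∀

claim3p7 : (r k n : ℕ) → (r≤n : r ≤ n) → (F : Fin r → Family n) →
    (∀ (j : Fin r) (S : Subset n) → F j S ≡ true → ∣ S ∣ ≡ k) →
    + card (⋃F F) ≤ℤ
      ((+ (n C k) - + ((n ∸ r) C k))
        + sumℤ r (λ j → + card (F-without (F j) (inject≤ j r≤n))
                        - + card (missingLink n r k (F j) (inject≤ j r≤n))))
claim3p7 r k n r≤n F F-size = begin
  + card (⋃F F)
    ≤⟨ m+[o+n]≤p+q⇒m≤[p-o]+[q-n] {card (⋃F F)} {∑[ j < r ] missing j} {(n ∸ r) C k}
                                  {n C k} {∑[ j < r ] without j} card-⋃F-bound ⟩
  (+ (n C k) - + ((n ∸ r) C k)) + (+ ∑[ j < r ] without j - + ∑[ j < r ] missing j)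
    ≡⟨ cong (_+_ (+ (n C k) - + ((n ∸ r) C k))) (sumℤ-pos-sub r without missing) ⟨
  (+ (n C k) - + ((n ∸ r) C k)) + sumℤ r (λ j → + without j - + missing j)  ∎
  where
  open UnionBound r k n r≤n F F-size
  open ≤-Reasoning
  without missing : Fin r → ℕ
  without j = card (F-without (F j) (ι j))
  missing j = card (missingLink n r k (F j) (ι j))
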